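{- Let $N$ and $v$ be integers with $3\le v<N$, and let $a=\lfloor\frac Nv\rfloor$. Then \[(v-1)\sum_{i=0}^{a-1}\binom{N}{i}<\binom{N}{a+2}.\] -}

module Defs where

open import Data.Nat using (ℕ; zero; suc; _+_)

sumBelow : ℕ → (ℕ → ℕ) → ℕ
sumBelow zero    f = 0
sumBelow (suc n) f = sumBelow n f + f n

-- Write c k = N C k, S k = Σ_{i<k} c i, v = p + 2 and a = ⌊N/v⌋.  The ratio identity
-- (k+1) c (k+1) = (N − k) c k shows that, as long as (k+1) v ≤ N, the terms grow fast enough
-- to keep the partial sums small: (1 + p k) S k ≤ k c k holds for k = 0 and propagates, with
-- strict inequality, up to k = a.  Two more ratio steps turn (1 + p a) S a < a c a into
-- (p+1) S a < c (a+2), provided (p+1) a (a+1) (a+2) ≤ (1 + p a)(N − a)(N − a − 1).  That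
-- polynomial inequality holds when v ≥ 4 or a ≥ 3; the remaining cases v = 3, 4 ≤ N ≤ 8 are
-- evaluated.
module Submission where

open import Defs
open import Data.Nat using (ℕ; z≤n; s≤s; _*_; _∸_; _+_; _≤_; _<_; _/_; >-nonZero)
open import Data.Nat.Properties using (<-≤-trans)
open import Data.Nat.Combinatorics using (_C_)

open import Data.Nat using (zero; suc; _>_; _≤?_; s≤s⁻¹)
open import Data.Nat.Properties
open import Data.Nat.Combinatorics using (nCk≡nC[n∸k]; nCn≡1; nC1≡n; k>n⇒nCk≡0; nCk+nC[k+1]≡[n+1]C[k+1])
open import Data.Nat.DivMod using (m/n*n≤m; m≥n⇒m/n>0; /-monoˡ-≤)
open import Data.Nat.Tactic.RingSolver using (solve-∀)
open import Data.Sum using (_⊎_; inj₁; inj₂; map₂)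
open import Relation.Binary.PropositionalEquality using (_≡_; refl; sym; trans; cong; cong₂; subst; module ≡-Reasoning)
open import Relation.Nullary using (yes; no)

nC0≡1 : ∀ n → n C 0 ≡ 1
nC0≡1 n = trans (nCk≡nC[n∸k] {k = 0} {n = n} z≤n) (nCn≡1 n)

0C[1+k]≡0 : ∀ k → 0 C suc k ≡ 0
0C[1+k]≡0 k = k>n⇒nCk≡0 {n = 0} {k = suc k} (s≤s z≤n)

k≤n⇒nCk>0 : ∀ {n k} → k ≤ n → n C k > 0
k≤n⇒nCk>0 {n}     {zero}  _         rewrite nC0≡1 n = s≤s z≤n
k≤n⇒nCk>0 {suc n} {suc k} (s≤s k≤n) rewrite sym (nCk+nC[k+1]≡[n+1]C[k+1] n k) =
  ≤-trans (k≤n⇒nCk>0 k≤n) (m≤m+n _ _)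

[1+k]*nC[1+k]+k*nCk≡n*nCk : ∀ n k → suc k * (n C suc k) + k * (n C k) ≡ n * (n C k)
[1+k]*nC[1+k]+k*nCk≡n*nCk zero    zero    = refl
[1+k]*nC[1+k]+k*nCk≡n*nCk zero    (suc k) rewrite 0C[1+k]≡0 (suc k) | 0C[1+k]≡0 k =
  cong₂ _+_ (*-zeroʳ (suc (suc k))) (*-zeroʳ (suc k))
[1+k]*nC[1+k]+k*nCk≡n*nCk (suc n) zero    rewrite nC1≡n (suc n) | nC0≡1 n =
  trans (+-identityʳ _) (*-comm 1 (suc n))
[1+k]*nC[1+k]+k*nCk≡n*nCk (suc n) (suc k) = begin
  suc (suc k) * (suc n C suc (suc k)) + suc k * (suc n C suc k)
    ≡⟨ cong₂ (λ u w → suc (suc k) * u + suc k * w) (sym (pascal n (suc k))) (sym (pascal n k)) ⟩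
  suc (suc k) * (y + z) + suc k * (x + y)
    ≡⟨ regroup k x y z ⟩
  (suc (suc k) * z + suc k * y) + (suc k * y + k * x) + (x + y)
    ≡⟨ cong₂ (λ u w → u + w + (x + y)) ([1+k]*nC[1+k]+k*nCk≡n*nCk n (suc k)) ([1+k]*nC[1+k]+k*nCk≡n*nCk n k) ⟩
  n * y + n * x + (x + y)
    ≡⟨ collect n x y ⟩
  suc n * (x + y)
    ≡⟨ cong (suc n *_) (pascal n k) ⟩
  suc n * (suc n C suc k) ∎
  where
  open ≡-Reasoning
  pascal = nCk+nC[k+1]≡[n+1]C[k+1]
  x = n C k
  y = n C suc k
  z = n C suc (suc k)
  regroup : ∀ k x y z → suc (suc k) * (y + z) + suc k * (x + y) ≡
                        (suc (suc k) * z + suc k * y) + (suc k * y + k * x) + (x + y)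
  regroup = solve-∀
  collect : ∀ n x y → n * y + n * x + (x + y) ≡ suc n * (x + y)
  collect = solve-∀

[1+k]*nC[1+k]≡[n∸k]*nCk : ∀ n k → suc k * (n C suc k) ≡ (n ∸ k) * (n C k)
[1+k]*nC[1+k]≡[n∸k]*nCk n k = begin
  suc k * (n C suc k)                             ≡⟨ m+n∸n≡m _ (k * (n C k)) ⟨
  suc k * (n C suc k) + k * (n C k) ∸ k * (n C k) ≡⟨ cong (_∸ k * (n C k)) ([1+k]*nC[1+k]+k*nCk≡n*nCk n k) ⟩
  n * (n C k) ∸ k * (n C k)                       ≡⟨ *-distribʳ-∸ (n C k) n k ⟨
  (n ∸ k) * (n C k)                               ∎
  where open ≡-Reasoning

-- The margin of 1 is (1 + p k + p)(k + 1 + p k) + 1 = (1 + p k)((p + 1)(k + 1) + 1).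
partialSum-step : ∀ p k {m S c c′} → suc (suc p * suc k) ≤ m → c > 0 →
  suc (p * k) * S ≤ k * c → suc k * c′ ≡ m * c →
  suc (p * suc k) * (S + c) < suc k * c′
partialSum-step p k {m} {S} {c} {c′} m≥ c>0 hyp ratio = *-cancelˡ-< D _ _ (begin-strict
  D * (D′ * (S + c))          ≡⟨ expand p k S c ⟩
  D′ * (D * S) + D′ * D * c   ≤⟨ +-monoˡ-≤ (D′ * D * c) (*-monoʳ-≤ D′ hyp) ⟩
  D′ * (k * c) + D′ * D * c   ≡⟨ collect p k c ⟩
  D′ * (k + D) * c            <⟨ m<m+n _ c>0 ⟩
  D′ * (k + D) * c + c        ≡⟨ margin p k c ⟩
  D * suc (suc p * suc k) * c ≤⟨ *-monoˡ-≤ c (*-monoʳ-≤ D m≥) ⟩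
  D * m * c                   ≡⟨ *-assoc D m c ⟩
  D * (m * c)                 ≡⟨ cong (D *_) ratio ⟨
  D * (suc k * c′)            ∎)
  where
  open ≤-Reasoning
  D D′ : ℕ
  D  = suc (p * k)
  D′ = suc (p * suc k)
  expand : ∀ p k S c → suc (p * k) * (suc (p * suc k) * (S + c)) ≡
                       suc (p * suc k) * (suc (p * k) * S) + suc (p * suc k) * suc (p * k) * c
  expand = solve-∀
  collect : ∀ p k c → suc (p * suc k) * (k * c) + suc (p * suc k) * suc (p * k) * c ≡
                      suc (p * suc k) * (k + suc (p * k)) * c
  collect = solve-∀
  margin : ∀ p k c → suc (p * suc k) * (k + suc (p * k)) * c + c ≡ suc (p * k) * suc (suc p * suc k) * c
  margin = solve-∀

two-ratio-steps : ∀ p a M M′ {S c₀ c₁ c₂} → suc (p * a) * S < a * c₀ →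
  suc a * c₁ ≡ M * c₀ → suc (suc a) * c₂ ≡ M′ * c₁ →
  suc p * a * suc a * suc (suc a) ≤ suc (p * a) * M * M′ →
  suc p * S < c₂
two-ratio-steps p a M M′ {S} {c₀} {c₁} {c₂} hyp ratio₁ ratio₂ growth = *-cancelˡ-< K _ _ (begin-strict
  K * (suc p * S)                            ≡⟨ e₁ D a p S ⟩
  suc p * (suc a * (suc (suc a) * (D * S)))  <⟨ *-monoʳ-< (suc p) (*-monoʳ-< (suc a) (*-monoʳ-< (suc (suc a)) hyp)) ⟩
  suc p * (suc a * (suc (suc a) * (a * c₀))) ≡⟨ e₂ p a c₀ ⟩
  suc p * a * suc a * suc (suc a) * c₀       ≤⟨ *-monoˡ-≤ c₀ growth ⟩
  D * M * M′ * c₀                            ≡⟨ e₃ D M M′ c₀ ⟩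
  D * M′ * (M * c₀)                          ≡⟨ cong (D * M′ *_) ratio₁ ⟨
  D * M′ * (suc a * c₁)                      ≡⟨ e₄ D M′ a c₁ ⟩
  D * suc a * (M′ * c₁)                      ≡⟨ cong (D * suc a *_) ratio₂ ⟨
  D * suc a * (suc (suc a) * c₂)             ≡⟨ e₅ D a c₂ ⟩
  K * c₂                                     ∎)
  where
  open ≤-Reasoning
  D K : ℕ
  D = suc (p * a)
  K = D * (suc a * suc (suc a))
  e₁ : ∀ D a p S → D * (suc a * suc (suc a)) * (suc p * S) ≡ suc p * (suc a * (suc (suc a) * (D * S)))
  e₁ = solve-∀
  e₂ : ∀ p a c → suc p * (suc a * (suc (suc a) * (a * c))) ≡ suc p * a * suc a * suc (suc a) * c
  e₂ = solve-∀
  e₃ : ∀ D M M′ c → D * M * M′ * c ≡ D * M′ * (M * c)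
  e₃ = solve-∀
  e₄ : ∀ D M′ a c → D * M′ * (suc a * c) ≡ D * suc a * (M′ * c)
  e₄ = solve-∀
  e₅ : ∀ D a c → D * suc a * (suc (suc a) * c) ≡ D * (suc a * suc (suc a)) * c
  e₅ = solve-∀

[1+p+pb][p+b+pb]-mono : ∀ b {p q} → p ≤ q →
  suc (p * suc b) * (suc p * b + p) ≤ suc (q * suc b) * (suc q * b + q)
[1+p+pb][p+b+pb]-mono b p≤q = *-mono-≤ (s≤s (*-monoˡ-≤ (suc b) p≤q)) (+-mono-≤ (*-monoˡ-≤ b (s≤s p≤q)) p≤q)

[2+b][3+b]≤[1+p+pb][p+b+pb] : ∀ p b → 1 ≤ p → 2 ≤ p ⊎ 2 ≤ b →
  suc (suc b) * suc (suc (suc b)) ≤ suc (p * suc b) * (suc p * b + p)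
[2+b][3+b]≤[1+p+pb][p+b+pb] p b _ (inj₁ 2≤p) = begin
  suc (suc b) * suc (suc (suc b))                         ≤⟨ m≤m+n _ _ ⟩
  suc (suc b) * suc (suc (suc b)) + (5 * (b * b) + 8 * b) ≡⟨ at-2 b ⟩
  suc (2 * suc b) * (suc 2 * b + 2)                       ≤⟨ [1+p+pb][p+b+pb]-mono b 2≤p ⟩
  suc (p * suc b) * (suc p * b + p)                       ∎
  where
  open ≤-Reasoning
  at-2 : ∀ b → suc (suc b) * suc (suc (suc b)) + (5 * (b * b) + 8 * b) ≡ suc (2 * suc b) * (suc 2 * b + 2)
  at-2 = solve-∀
[2+b][3+b]≤[1+p+pb][p+b+pb] p b@(suc (suc s)) 1≤p (inj₂ (s≤s (s≤s _))) = begin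
  suc (suc b) * suc (suc (suc b))                    ≤⟨ m≤m+n _ _ ⟩
  suc (suc b) * suc (suc (suc b)) + (s * s + 4 * s)  ≡⟨ at-1 s ⟩
  suc (1 * suc b) * (suc 1 * b + 1)                  ≤⟨ [1+p+pb][p+b+pb]-mono b 1≤p ⟩
  suc (p * suc b) * (suc p * b + p)                  ∎
  where
  open ≤-Reasoning
  at-1 : ∀ s → suc (suc (suc (suc s))) * suc (suc (suc (suc (suc s)))) + (s * s + 4 * s) ≡
               suc (1 * suc (suc (suc s))) * (suc 1 * suc (suc s) + 1)
  at-1 = solve-∀

module _ (N p : ℕ) where

  private
    v : ℕ
    v = suc (suc p)

  partialSum≤ : ∀ k → k * v ≤ N → suc (p * k) * sumBelow k (N C_) ≤ k * (N C k)
  partialSum< : ∀ k → suc k * v ≤ N → suc (p * suc k) * sumBelow (suc k) (N C_) < suc k * (N C suc k)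

  partialSum≤ zero    _  = ≤-reflexive (*-zeroʳ (suc (p * 0)))
  partialSum≤ (suc k) le = <⇒≤ (partialSum< k le)

  partialSum< k le = partialSum-step p k N∸k≥ (k≤n⇒nCk>0 k≤N)
    (partialSum≤ k (≤-trans (*-monoˡ-≤ v (n≤1+n k)) le)) ([1+k]*nC[1+k]≡[n∸k]*nCk N k)
    where
    split : ∀ p k → suc k * suc (suc p) ≡ suc (suc p * suc k) + k
    split = solve-∀
    N∸k≥ : suc (suc p * suc k) ≤ N ∸ k
    N∸k≥ = m+n≤o⇒m≤o∸n _ (subst (_≤ N) (split p k) le)
    k≤N : k ≤ N
    k≤N = ≤-trans (≤-trans (n≤1+n k) (m≤m*n (suc k) v)) le

  growth-bound : ∀ b → suc b * v ≤ N → 1 ≤ p → 2 ≤ p ⊎ 2 ≤ b →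
    suc p * suc b * suc (suc b) * suc (suc (suc b)) ≤ suc (p * suc b) * (N ∸ suc b) * (N ∸ suc (suc b))
  growth-bound b le 1≤p cond = begin
    suc p * suc b * suc (suc b) * suc (suc (suc b))   ≡⟨ *-assoc (suc p * suc b) (suc (suc b)) (suc (suc (suc b))) ⟩
    suc p * suc b * (suc (suc b) * suc (suc (suc b))) ≤⟨ *-monoʳ-≤ (suc p * suc b) ([2+b][3+b]≤[1+p+pb][p+b+pb] p b 1≤p cond) ⟩
    suc p * suc b * (D * (suc p * b + p))             ≡⟨ rearrange (suc p * suc b) D (suc p * b + p) ⟩
    D * (suc p * suc b) * (suc p * b + p)             ≤⟨ *-mono-≤ (*-monoʳ-≤ D N∸[1+b]≥) N∸[2+b]≥ ⟩
    D * (N ∸ suc b) * (N ∸ suc (suc b))               ∎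
    where
    open ≤-Reasoning
    D : ℕ
    D = suc (p * suc b)
    rearrange : ∀ x y z → x * (y * z) ≡ y * x * z
    rearrange = solve-∀
    split₁ : ∀ p b → suc b * suc (suc p) ≡ suc p * suc b + suc b
    split₁ = solve-∀
    split₂ : ∀ p b → suc b * suc (suc p) ≡ suc p * b + p + suc (suc b)
    split₂ = solve-∀
    N∸[1+b]≥ : suc p * suc b ≤ N ∸ suc b
    N∸[1+b]≥ = m+n≤o⇒m≤o∸n _ (subst (_≤ N) (split₁ p b) le)
    N∸[2+b]≥ : suc p * b + p ≤ N ∸ suc (suc b)
    N∸[2+b]≥ = m+n≤o⇒m≤o∸n _ (subst (_≤ N) (split₂ p b) le)

  [1+p]*sumBelow[a]<C[a+2] : ∀ a → 1 ≤ a → a * v ≤ N → 1 ≤ p → 2 ≤ p ⊎ 3 ≤ a →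
    suc p * sumBelow a (N C_) < N C (a + 2)
  [1+p]*sumBelow[a]<C[a+2] (suc b) _ le 1≤p cond =
    subst (λ j → suc p * sumBelow (suc b) (N C_) < N C suc j) (+-comm 2 b)
      (two-ratio-steps p (suc b) (N ∸ suc b) (N ∸ suc (suc b)) (partialSum< b le)
        ([1+k]*nC[1+k]≡[n∸k]*nCk N (suc b)) ([1+k]*nC[1+k]≡[n∸k]*nCk N (suc (suc b)))
        (growth-bound b le 1≤p (map₂ s≤s⁻¹ cond)))

-- For v = 3 the growth bound fails at N = 6 (a = 2); there the theorem is tight: 14 < 15.
v≡3∧N≤8-case : ∀ N → 3 < N → N ≤ 8 → 2 * sumBelow (N / 3) (N C_) < N C (N / 3 + 2)
v≡3∧N≤8-case 4 (s≤s (s≤s (s≤s (s≤s _)))) _ = ≤ᵇ⇒≤ _ _ _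
v≡3∧N≤8-case 5 (s≤s (s≤s (s≤s (s≤s _)))) _ = ≤ᵇ⇒≤ _ _ _
v≡3∧N≤8-case 6 (s≤s (s≤s (s≤s (s≤s _)))) _ = ≤ᵇ⇒≤ _ _ _
v≡3∧N≤8-case 7 (s≤s (s≤s (s≤s (s≤s _)))) _ = ≤ᵇ⇒≤ _ _ _
v≡3∧N≤8-case 8 (s≤s (s≤s (s≤s (s≤s _)))) _ = ≤ᵇ⇒≤ _ _ _
v≡3∧N≤8-case (suc (suc (suc (suc (suc (suc (suc (suc (suc _))))))))) _
  (s≤s (s≤s (s≤s (s≤s (s≤s (s≤s (s≤s (s≤s ()))))))))

lemma4p2 : (N v : ℕ) → (3≤v : 3 ≤ v) → v < N →
    let a = _/_ N v {{ >-nonZero (<-≤-trans (s≤s z≤n) 3≤v) }} in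
    (v ∸ 1) * sumBelow a (λ i → N C i) < N C (a + 2)
lemma4p2 N v@(suc (suc (suc (suc r)))) (s≤s (s≤s (s≤s _))) v<N =
  [1+p]*sumBelow[a]<C[a+2] N (suc (suc r)) (N / v) (m≥n⇒m/n>0 (<⇒≤ v<N)) (m/n*n≤m N v)
    (s≤s z≤n) (inj₁ (s≤s (s≤s z≤n)))
lemma4p2 N 3 (s≤s (s≤s (s≤s _))) v<N with N ≤? 8
... | yes N≤8 = v≡3∧N≤8-case N v<N N≤8
... | no  N≰8 = [1+p]*sumBelow[a]<C[a+2] N 1 (N / 3) (m≥n⇒m/n>0 (<⇒≤ v<N)) (m/n*n≤m N 3)
                  ≤-refl (inj₂ (/-monoˡ-≤ 3 (≰⇒> N≰8)))
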